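{- Let $(P_n)_{n\in\mathbb{Z}}$ be the Padovan sequence. Suppose that for each $a\in\{1,\dots,8\}$, $(\rho_a,\sigma_a)$ is a pair of integers such that $P_n=\rho_aP_{n-a}+\sigma_aP_{n-2a}+P_{n-3a}$ for all integers $n$. Then: (1) for $1\le b\le 5$, $\rho_{b+3}=\rho_{b+1}+\rho_b$, with $\rho_1=0$, $\rho_2=2$, $\rho_3=3$; and $\sigma_{b+3}=\sigma_b-\sigma_{b+2}$, with $\sigma_1=1$, $\sigma_2=-1$, $\sigma_3=-2$; (2) for $1\le a\le 8$, $\rho_a=3P_{a-2}-P_{a-4}$ and $\sigma_a=-\rho_{ -a}$, where for a negative integer $c$ one sets $\rho_c:=3P_{c-2}-P_{c-4}$.
   Context: The Padovan numbers are defined by $P_0=P_1=P_2=1$ and $P_{n+3}=P_{n+1}+P_n$ for $n\ge 0$; the sequence is extended to all integers $n$ by the recurrence read backwards, $P_n=P_{n+3}-P_{n+1}$. -}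

module Defs where

open import Data.Nat using (ℕ; zero; suc)
open import Data.Integer using (ℤ; +_; -[1+_]; _-_; _+_; _*_)
open import Data.Product using (_×_; _,_; proj₁)

padℕ : ℕ → ℤ
padℕ 0 = + 1
padℕ 1 = + 1
padℕ 2 = + 1
padℕ (suc (suc (suc n))) = padℕ (suc n) + padℕ n

-- triple (P_{-k}, P_{-k+1}, P_{-k+2}), extended backwards by P_n = P_{n+3} - P_{n+1}
padNegTriple : ℕ → ℤ × ℤ × ℤ
padNegTriple zero = (+ 1 , + 1 , + 1)
padNegTriple (suc k) with padNegTriple k
... | (a , b , c) = (c - a , a , b)

P : ℤ → ℤ
P (+ n) = padℕ n
P -[1+ k ] = proj₁ (padNegTriple (suc k))

-- A three-term relation P n = ρ P(n−a) + σ P(n−2a) + P(n−3a) pins its coefficients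
-- down from a single value of n: if P(n−2a) = 0 ≠ P(n−a) it isolates ρ, and if
-- P(n−a) = 0 ≠ P(n−2a) it isolates σ. The Padovan zeros P₋₁ = P₋₃ = P₋₄ = 0 provide
-- such n for every a ≤ 8, and at those n the claimed closed forms satisfy the
-- relation by evaluation. The recurrences of part (1) are then read off the closed forms.
module Submission where

open import Defs
open import Data.Nat using (ℕ; suc; _≤_; z≤n; s≤s)
open import Data.Nat.Properties using (m≤n+m; m≤n⇒m≤o+n)
open import Data.Integer using (ℤ; +_; -_; _-_; _+_; _*_; NonZero)
open import Data.Integer.Properties using (+-0-abelianGroup; *-cancelʳ-≡; *-zeroʳ; +-identityʳ; +-identityˡ)
open import Data.Product using (_×_; _,_)
open import Algebra.Bundles using (AbelianGroup)
open import Algebra.Properties.Group (AbelianGroup.group +-0-abelianGroup) using (∙-cancelʳ)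
open import Relation.Binary.PropositionalEquality using (_≡_; refl; sym; cong₂; subst)
open Relation.Binary.PropositionalEquality.≡-Reasoning

RecurrenceAt : ℕ → ℤ → ℤ → ℤ → Set
RecurrenceAt a r s n = P n ≡ r * P (n - + a) + s * P (n - + 2 * + a) + P (n - + 3 * + a)

ρClosed : ℤ → ℤ
ρClosed c = + 3 * P (c - + 2) - P (c - + 4)

σClosed : ℕ → ℤ
σClosed a = - ρClosed (- + a)

coefficientˡ-unique : ∀ {c z t} x y x′ y′ .{{_ : NonZero c}} → z ≡ + 0 →
  x * c + y * z + t ≡ x′ * c + y′ * z + t → x ≡ x′
coefficientˡ-unique {c} {t = t} x y x′ y′ refl eq
  rewrite *-zeroʳ y | *-zeroʳ y′ | +-identityʳ (x * c) | +-identityʳ (x′ * c)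
  = *-cancelʳ-≡ x x′ c (∙-cancelʳ t (x * c) (x′ * c) eq)

coefficientʳ-unique : ∀ {c z t} x y x′ y′ .{{_ : NonZero c}} → z ≡ + 0 →
  x * z + y * c + t ≡ x′ * z + y′ * c + t → y ≡ y′
coefficientʳ-unique {c} {t = t} x y x′ y′ refl eq
  rewrite *-zeroʳ x | *-zeroʳ x′ | +-identityˡ (y * c) | +-identityˡ (y′ * c)
  = *-cancelʳ-≡ y y′ c (∙-cancelʳ t (y * c) (y′ * c) eq)

ρClosed-padovan : ∀ b → 1 ≤ b → b ≤ 5 →
  ρClosed (+ (3 Data.Nat.+ b)) ≡ ρClosed (+ (1 Data.Nat.+ b)) + ρClosed (+ b)
ρClosed-padovan 1 _ _ = refl
ρClosed-padovan 2 _ _ = refl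
ρClosed-padovan 3 _ _ = refl
ρClosed-padovan 4 _ _ = refl
ρClosed-padovan 5 _ _ = refl
ρClosed-padovan 0 () _
ρClosed-padovan (suc (suc (suc (suc (suc (suc b)))))) _ (s≤s (s≤s (s≤s (s≤s (s≤s ())))))

σClosed-recurrence : ∀ b → 1 ≤ b → b ≤ 5 →
  σClosed (3 Data.Nat.+ b) ≡ σClosed b - σClosed (2 Data.Nat.+ b)
σClosed-recurrence 1 _ _ = refl
σClosed-recurrence 2 _ _ = refl
σClosed-recurrence 3 _ _ = refl
σClosed-recurrence 4 _ _ = refl
σClosed-recurrence 5 _ _ = refl
σClosed-recurrence 0 () _
σClosed-recurrence (suc (suc (suc (suc (suc (suc b)))))) _ (s≤s (s≤s (s≤s (s≤s (s≤s ())))))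

module Coefficients (ρ σ : ℕ → ℤ)
  (rec : ∀ a → 1 ≤ a → a ≤ 8 → ∀ n → RecurrenceAt a (ρ a) (σ a) n) where

  ρ-from-probe : ∀ a → 1 ≤ a → a ≤ 8 → ∀ n .{{_ : NonZero (P (n - + a))}} →
    P (n - + 2 * + a) ≡ + 0 → RecurrenceAt a (ρClosed (+ a)) (σClosed a) n →
    ρ a ≡ ρClosed (+ a)
  ρ-from-probe a 1≤a a≤8 n vanishes closed =
    coefficientˡ-unique (ρ a) (σ a) (ρClosed (+ a)) (σClosed a) vanishes
      (subst (_≡ _) (rec a 1≤a a≤8 n) closed)

  σ-from-probe : ∀ a → 1 ≤ a → a ≤ 8 → ∀ n .{{_ : NonZero (P (n - + 2 * + a))}} →
    P (n - + a) ≡ + 0 → RecurrenceAt a (ρClosed (+ a)) (σClosed a) n →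
    σ a ≡ σClosed a
  σ-from-probe a 1≤a a≤8 n vanishes closed =
    coefficientʳ-unique (ρ a) (σ a) (ρClosed (+ a)) (σClosed a) vanishes
      (subst (_≡ _) (rec a 1≤a a≤8 n) closed)

  -- Probing at n = 2a − 1 puts n − 2a at the zero P₋₁; the σ-probes put n − a at one
  -- of the zeros P₋₁, P₋₃, P₋₄ while keeping P(n − 2a) ≠ 0.
  ρ-closed : ∀ a → 1 ≤ a → a ≤ 8 → ρ a ≡ ρClosed (+ a)
  ρ-closed 1 p q = ρ-from-probe 1 p q (+ 1) refl refl
  ρ-closed 2 p q = ρ-from-probe 2 p q (+ 3) refl refl
  ρ-closed 3 p q = ρ-from-probe 3 p q (+ 5) refl refl
  ρ-closed 4 p q = ρ-from-probe 4 p q (+ 7) refl refl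
  ρ-closed 5 p q = ρ-from-probe 5 p q (+ 9) refl refl
  ρ-closed 6 p q = ρ-from-probe 6 p q (+ 11) refl refl
  ρ-closed 7 p q = ρ-from-probe 7 p q (+ 13) refl refl
  ρ-closed 8 p q = ρ-from-probe 8 p q (+ 15) refl refl
  ρ-closed 0 () _
  ρ-closed (suc (suc (suc (suc (suc (suc (suc (suc (suc _))))))))) _
    (s≤s (s≤s (s≤s (s≤s (s≤s (s≤s (s≤s (s≤s ()))))))))

  σ-closed : ∀ a → 1 ≤ a → a ≤ 8 → σ a ≡ σClosed a
  σ-closed 1 p q = σ-from-probe 1 p q (+ 0) refl refl
  σ-closed 2 p q = σ-from-probe 2 p q (- + 1) refl refl
  σ-closed 3 p q = σ-from-probe 3 p q (+ 0) refl refl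
  σ-closed 4 p q = σ-from-probe 4 p q (+ 3) refl refl
  σ-closed 5 p q = σ-from-probe 5 p q (+ 4) refl refl
  σ-closed 6 p q = σ-from-probe 6 p q (+ 5) refl refl
  σ-closed 7 p q = σ-from-probe 7 p q (+ 4) refl refl
  σ-closed 8 p q = σ-from-probe 8 p q (+ 5) refl refl
  σ-closed 0 () _
  σ-closed (suc (suc (suc (suc (suc (suc (suc (suc (suc _))))))))) _
    (s≤s (s≤s (s≤s (s≤s (s≤s (s≤s (s≤s (s≤s ()))))))))

  ρ-padovan : ∀ b → 1 ≤ b → b ≤ 5 → ρ (3 Data.Nat.+ b) ≡ ρ (1 Data.Nat.+ b) + ρ b
  ρ-padovan b 1≤b b≤5 = begin
    ρ (3 Data.Nat.+ b)                            ≡⟨ ρ-closed _ (s≤s z≤n) 3+b≤8 ⟩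
    ρClosed (+ (3 Data.Nat.+ b))                  ≡⟨ ρClosed-padovan b 1≤b b≤5 ⟩
    ρClosed (+ (1 Data.Nat.+ b)) + ρClosed (+ b)  ≡⟨ sym (cong₂ _+_ (ρ-closed _ (s≤s z≤n) 1+b≤8) (ρ-closed b 1≤b b≤8)) ⟩
    ρ (1 Data.Nat.+ b) + ρ b                      ∎
    where
    b≤8 : b ≤ 8
    b≤8 = m≤n⇒m≤o+n 3 b≤5
    1+b≤8 : 1 Data.Nat.+ b ≤ 8
    1+b≤8 = s≤s (m≤n⇒m≤o+n 2 b≤5)
    3+b≤8 : 3 Data.Nat.+ b ≤ 8
    3+b≤8 = s≤s (s≤s (s≤s b≤5))

  σ-recurrence : ∀ b → 1 ≤ b → b ≤ 5 → σ (3 Data.Nat.+ b) ≡ σ b - σ (2 Data.Nat.+ b)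
  σ-recurrence b 1≤b b≤5 = begin
    σ (3 Data.Nat.+ b)                    ≡⟨ σ-closed _ (s≤s z≤n) 3+b≤8 ⟩
    σClosed (3 Data.Nat.+ b)              ≡⟨ σClosed-recurrence b 1≤b b≤5 ⟩
    σClosed b - σClosed (2 Data.Nat.+ b)  ≡⟨ sym (cong₂ _-_ (σ-closed b 1≤b b≤8) (σ-closed _ (s≤s z≤n) 2+b≤8)) ⟩
    σ b - σ (2 Data.Nat.+ b)              ∎
    where
    b≤8 : b ≤ 8
    b≤8 = m≤n⇒m≤o+n 3 b≤5
    2+b≤8 : 2 Data.Nat.+ b ≤ 8
    2+b≤8 = s≤s (s≤s (m≤n⇒m≤o+n 1 b≤5))
    3+b≤8 : 3 Data.Nat.+ b ≤ 8
    3+b≤8 = s≤s (s≤s (s≤s b≤5))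

mainTheorem3 : (ρ σ : ℕ → ℤ) →
    (∀ (a : ℕ) → 1 ≤ a → a ≤ 8 → ∀ (n : ℤ) →
      P n ≡ ρ a * P (n - + a) + σ a * P (n - + 2 * + a) + P (n - + 3 * + a)) →
    ((∀ (b : ℕ) → 1 ≤ b → b ≤ 5 → ρ (3 Data.Nat.+ b) ≡ ρ (1 Data.Nat.+ b) + ρ b)
      × ρ 1 ≡ + 0 × ρ 2 ≡ + 2 × ρ 3 ≡ + 3
      × (∀ (b : ℕ) → 1 ≤ b → b ≤ 5 → σ (3 Data.Nat.+ b) ≡ σ b - σ (2 Data.Nat.+ b))
      × σ 1 ≡ + 1 × σ 2 ≡ - + 1 × σ 3 ≡ - + 2)
    × (∀ (a : ℕ) → 1 ≤ a → a ≤ 8 →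
        (ρ a ≡ + 3 * P (+ a - + 2) - P (+ a - + 4))
        × (σ a ≡ - (+ 3 * P (- + a - + 2) - P (- + a - + 4))))
mainTheorem3 ρ σ rec =
  ( ρ-padovan , ρ-closed 1 one≤ (m≤n+m 1 7) , ρ-closed 2 one≤ (m≤n+m 2 6) , ρ-closed 3 one≤ (m≤n+m 3 5)
  , σ-recurrence , σ-closed 1 one≤ (m≤n+m 1 7) , σ-closed 2 one≤ (m≤n+m 2 6) , σ-closed 3 one≤ (m≤n+m 3 5) )
  , λ a 1≤a a≤8 → ρ-closed a 1≤a a≤8 , σ-closed a 1≤a a≤8
  where
  open Coefficients ρ σ rec
  one≤ : ∀ {k} → 1 ≤ suc k
  one≤ = s≤s z≤n
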